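{- For every integer $k\ge 2$ there exist a positive integer $t$ and a tree $T$ with maximum degree $\Delta(T)=k$ such that $\tau_t(S_k)<\tau_t(T)$.
   Context: $S_k$ is the star with $k$ leaves. For an integer $t\ge1$, a $t$-tone coloring of a graph $G$ assigns to each vertex $v$ a set $f(v)$ of exactly $t$ colors from a color set $C$ such that $|f(u)\cap f(v)|<d(u,v)$ for all distinct $u,v$, where $d$ is graph distance; $\tau_t(G)$ is the minimum $|C|$ over all such colorings. -}

module Defs where

open import Data.Nat using (ℕ; zero; suc; _≤_; _<_)
open import Data.Fin using (Fin; zero; suc)
open import Data.Fin.Subset using (Subset; _∩_; ∣_∣)
open import Data.Bool using (Bool; true; false; T)
open import Data.Vec using (tabulate)
open import Data.List using (List; _∷_; []; _++_; [_]; length)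
open import Data.List.Relation.Unary.Linked using (Linked)
open import Data.List.Relation.Unary.Unique.Propositional using (Unique)
open import Data.Product using (Σ; ∃; _×_; _,_)
open import Relation.Binary.PropositionalEquality using (_≡_; _≢_; refl)
open import Relation.Nullary using (¬_)
open import Data.Empty using (⊥)

record Graph : Set where
  field
    n      : ℕ
    adj    : Fin n → Fin n → Bool
    sym    : ∀ u v → adj u v ≡ adj v u
    irrefl : ∀ v → adj v v ≡ false

module _ (G : Graph) where
  open Graph G

  Adj : Fin n → Fin n → Set
  Adj u v = T (adj u v)

  data Walk : Fin n → Fin n → ℕ → Set where
    here : ∀ {u} → Walk u u 0
    step : ∀ {u w v m} → Adj u w → Walk w v m → Walk u v (suc m)

  Dist : Fin n → Fin n → ℕ → Set
  Dist u v d = Walk u v d × (∀ m → Walk u v m → d ≤ m)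

  Connected : Set
  Connected = ∀ u v → ∃ λ m → Walk u v m

  IsCycle : List (Fin n) → Set
  IsCycle [] = ⊥
  IsCycle (x ∷ rest) = 3 ≤ length (x ∷ rest) × Unique (x ∷ rest)
                       × Linked Adj ((x ∷ rest) ++ [ x ])

  Acyclic : Set
  Acyclic = ∀ (vs : List (Fin n)) → ¬ IsCycle vs

  IsTree : Set
  IsTree = Connected × Acyclic

  degree : Fin n → ℕ
  degree v = ∣ tabulate (adj v) ∣

  MaxDegree : ℕ → Set
  MaxDegree k = (∀ v → degree v ≤ k) × ∃ λ v → degree v ≡ k

  ToneColoring : ℕ → ℕ → Set
  ToneColoring t c =
    Σ (Fin n → Subset c) λ f →
      (∀ v → ∣ f v ∣ ≡ t) ×
      (∀ u v → u ≢ v → ∀ d → Dist u v d → ∣ f u ∩ f v ∣ < d)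

  IsTau : ℕ → ℕ → Set
  IsTau t m = ToneColoring t m × (∀ c → ToneColoring t c → m ≤ c)

starAdj : ∀ k → Fin (suc k) → Fin (suc k) → Bool
starAdj k zero zero = false
starAdj k zero (suc _) = true
starAdj k (suc _) zero = true
starAdj k (suc _) (suc _) = false

Star : ℕ → Graph
Star k = record
  { n = suc k
  ; adj = starAdj k
  ; sym = s
  ; irrefl = i
  }
  where
  s : ∀ u v → starAdj k u v ≡ starAdj k v u
  s zero zero = refl
  s zero (suc _) = refl
  s (suc _) zero = refl
  s (suc _) (suc _) = refl
  i : ∀ v → starAdj k v v ≡ false
  i zero = refl
  i (suc _) = refl

-- Give the n vertices of a graph pairwise disjoint blocks of t colours: this
-- is a t-tone colouring with n·t colours, so τ_t(S_k) ≤ (k+1)t.  Conversely,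
-- in a graph of diameter at most 3 any two colour sets share at most 2
-- colours, so by the Bonferroni inequality a t-tone colouring of n vertices
-- uses at least n·t − 2·C(n,2) colours.  The broom obtained from S_k by
-- subdividing one edge is a tree with Δ = k, k+2 vertices and diameter 3;
-- taking t = 2·C(k+2,2) + 1 gives τ_t ≥ (k+2)t − (t − 1) > (k+1)t ≥ τ_t(S_k).
-- Both values of τ_t exist as least numbers of colours because t-tone
-- colourability with c colours is decidable.
module Submission where

open import Defs
open import Data.Nat using (ℕ; zero; suc; _+_; _*_; _≤_; _<_; z≤n; s≤s)
open import Data.Nat.Properties
  using (_≟_; ≤-refl; ≤-trans; ≤-reflexive; ≤-pred; ≤-<-trans; ≰⇒>; <⇒≱; ≮⇒≥;
         m≤m+n; +-mono-≤; +-monoˡ-≤; +-monoʳ-≤; +-suc; +-comm; +-assoc; +-identityʳ;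
         *-comm; *-distribˡ-+; +-cancelˡ-<; anyUpTo?; allUpTo?; module ≤-Reasoning)
open import Data.Nat.Combinatorics using (_C_; nC1≡n; nCk+nC[k+1]≡[n+1]C[k+1])
open import Data.Nat.Induction using (<-rec)
open import Data.Bool using (Bool; true; false; T; _∨_)
open import Data.Bool.Properties using (∨-comm)
open import Data.Unit using (tt)
open import Data.Empty using (⊥-elim)
open import Data.Fin using (Fin; zero; suc)
import Data.Fin.Properties as Finₚ
open import Data.Fin.Subset using (Subset; _∩_; _∪_; ∣_∣; ⊥; ⊤; ⋃; inside; outside)
open import Data.Fin.Subset.Properties
  using (∣p∣≤n; ∣⊥∣≡0; ∣⊤∣≡n; ∩-zeroˡ; ∩-zeroʳ; ∩-distribˡ-∪; anySubset?)
open import Data.Vec using ([]; _∷_; _++_; tabulate; replicate)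
open import Data.Vec.Properties using (zipWith-++; tabulate-∘; map-const)
open import Data.Vec.Functional using () renaming (_∷_ to _◂_)
import Data.List as List
open import Data.List using ([]; _∷_)
open import Data.List.Relation.Unary.Linked using ([-]; _∷_)
open import Data.List.Relation.Unary.AllPairs using ([]; _∷_)
open import Data.List.Relation.Unary.All using ([]; _∷_)
open import Data.Product using (Σ; ∃; ∃₂; _×_; _,_; proj₁; proj₂)
open import Data.Sum using (_⊎_; inj₁; inj₂; [_,_]′)
open import Function using (_∘_)
open import Relation.Nullary using (¬_; Dec; yes; no; ¬?)
open import Relation.Nullary.Decidable using (map′; T?; _×-dec_; _→-dec_)
open import Relation.Unary using (Decidable)
open import Relation.Binary.PropositionalEquality
  using (_≡_; _≢_; refl; sym; trans; cong; cong₂; subst; module ≡-Reasoning)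

-- Dist and IsTau are both instances of Least.
Least : (ℕ → Set) → ℕ → Set
Least P d = P d × (∀ e → P e → d ≤ e)

least : ∀ {P : ℕ → Set} → Decidable P → ∀ {m} → P m → ∃ (Least P)
least {P} P? {m} = <-rec (λ m → P m → ∃ (Least P)) below-or-here m
  where
  below-or-here : ∀ m → (∀ {n} → n < m → P n → ∃ (Least P)) → P m → ∃ (Least P)
  below-or-here m rec pm with anyUpTo? P? m
  ... | yes (n , n<m , pn) = rec n<m pn
  ... | no none = m , pm , λ e pe → ≮⇒≥ (λ e<m → none (e , e<m , pe))

Searchable : Set → Set₁
Searchable A = ∀ {P : A → Set} → Decidable P → Dec (∃ P)

-- Without function extensionality only predicates respecting pointwise
-- equality can be decided by searching Fin N → A coordinatewise.
search-Fin→ : ∀ {A} → Searchable A → ∀ N {P : (Fin N → A) → Set} →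
              (∀ {f g} → (∀ i → f i ≡ g i) → P f → P g) →
              Decidable P → Dec (∃ P)
search-Fin→ {A} any? zero {P} resp P? =
  map′ (λ p → empty , p) (λ (f , p) → resp (λ ()) p) (P? empty)
  where
  empty : Fin 0 → A
  empty ()
search-Fin→ any? (suc N) {P} resp P? =
  map′ (λ (a , g , p) → (a ◂ g) , p)
       (λ (f , p) → f zero , f ∘ suc , resp (λ { zero → refl ; (suc i) → refl }) p)
       (any? λ a → search-Fin→ any? N (resp ∘ ◂-cong a) (P? ∘ (a ◂_)))
  where
  ◂-cong : ∀ a {f g : Fin N → _} → (∀ i → f i ≡ g i) → ∀ i → (a ◂ f) i ≡ (a ◂ g) i
  ◂-cong a f≗g zero    = refl
  ◂-cong a f≗g (suc i) = f≗g i

-- Cardinalities of subsets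

∣p++q∣≡∣p∣+∣q∣ : ∀ {m n} (p : Subset m) (q : Subset n) → ∣ p ++ q ∣ ≡ ∣ p ∣ + ∣ q ∣
∣p++q∣≡∣p∣+∣q∣ []            q = refl
∣p++q∣≡∣p∣+∣q∣ (inside  ∷ p) q = cong suc (∣p++q∣≡∣p∣+∣q∣ p q)
∣p++q∣≡∣p∣+∣q∣ (outside ∷ p) q = ∣p++q∣≡∣p∣+∣q∣ p q

∣p++q∩p′++q′∣ : ∀ {m n} (p p′ : Subset m) (q q′ : Subset n) →
                ∣ (p ++ q) ∩ (p′ ++ q′) ∣ ≡ ∣ p ∩ p′ ∣ + ∣ q ∩ q′ ∣
∣p++q∩p′++q′∣ p p′ q q′ =
  trans (cong ∣_∣ (zipWith-++ _ p q p′ q′)) (∣p++q∣≡∣p∣+∣q∣ (p ∩ p′) (q ∩ q′))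

∣p∩⊥∣≡0 : ∀ {n} (p : Subset n) → ∣ p ∩ ⊥ ∣ ≡ 0
∣p∩⊥∣≡0 {n} p = trans (cong ∣_∣ (∩-zeroʳ p)) (∣⊥∣≡0 n)

∣⊥∩p∣≡0 : ∀ {n} (p : Subset n) → ∣ ⊥ ∩ p ∣ ≡ 0
∣⊥∩p∣≡0 {n} p = trans (cong ∣_∣ (∩-zeroˡ p)) (∣⊥∣≡0 n)

∣tabulate-const∣ : ∀ n x → ∣ tabulate {n = n} (λ _ → x) ∣ ≡ ∣ replicate n x ∣
∣tabulate-const∣ n x =
  cong ∣_∣ (trans (tabulate-∘ {n = n} (λ _ → x) (λ i → i)) (map-const (tabulate (λ i → i)) x))

∣p∪q∣+∣p∩q∣≡∣p∣+∣q∣ : ∀ {n} (p q : Subset n) → ∣ p ∪ q ∣ + ∣ p ∩ q ∣ ≡ ∣ p ∣ + ∣ q ∣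
∣p∪q∣+∣p∩q∣≡∣p∣+∣q∣ [] [] = refl
∣p∪q∣+∣p∩q∣≡∣p∣+∣q∣ (inside ∷ p) (inside ∷ q) =
  cong suc (trans (+-suc _ _) (trans (cong suc (∣p∪q∣+∣p∩q∣≡∣p∣+∣q∣ p q)) (sym (+-suc _ _))))
∣p∪q∣+∣p∩q∣≡∣p∣+∣q∣ (inside ∷ p) (outside ∷ q) = cong suc (∣p∪q∣+∣p∩q∣≡∣p∣+∣q∣ p q)
∣p∪q∣+∣p∩q∣≡∣p∣+∣q∣ (outside ∷ p) (inside ∷ q) =
  trans (cong suc (∣p∪q∣+∣p∩q∣≡∣p∣+∣q∣ p q)) (sym (+-suc _ _))
∣p∪q∣+∣p∩q∣≡∣p∣+∣q∣ (outside ∷ p) (outside ∷ q) = ∣p∪q∣+∣p∩q∣≡∣p∣+∣q∣ p q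

∣p∪q∣≤∣p∣+∣q∣ : ∀ {n} (p q : Subset n) → ∣ p ∪ q ∣ ≤ ∣ p ∣ + ∣ q ∣
∣p∪q∣≤∣p∣+∣q∣ p q =
  ≤-trans (m≤m+n ∣ p ∪ q ∣ ∣ p ∩ q ∣) (≤-reflexive (∣p∪q∣+∣p∩q∣≡∣p∣+∣q∣ p q))

⋃[_] : ∀ {N c} → (Fin N → Subset c) → Subset c
⋃[ f ] = ⋃ (List.tabulate f)

∣p∩⋃f∣≤N*s : ∀ {c s} N (f : Fin N → Subset c) (p : Subset c) →
             (∀ i → ∣ p ∩ f i ∣ ≤ s) → ∣ p ∩ ⋃[ f ] ∣ ≤ N * s
∣p∩⋃f∣≤N*s zero    f p bound = ≤-reflexive (∣p∩⊥∣≡0 p)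
∣p∩⋃f∣≤N*s {s = s} (suc N) f p bound = begin
  ∣ p ∩ (f zero ∪ ⋃[ f ∘ suc ]) ∣          ≡⟨ cong ∣_∣ (∩-distribˡ-∪ p (f zero) _) ⟩
  ∣ (p ∩ f zero) ∪ (p ∩ ⋃[ f ∘ suc ]) ∣    ≤⟨ ∣p∪q∣≤∣p∣+∣q∣ (p ∩ f zero) (p ∩ ⋃[ f ∘ suc ]) ⟩
  ∣ p ∩ f zero ∣ + ∣ p ∩ ⋃[ f ∘ suc ] ∣    ≤⟨ +-mono-≤ (bound zero) (∣p∩⋃f∣≤N*s N (f ∘ suc) p (bound ∘ suc)) ⟩
  s + N * s                               ∎
  where open ≤-Reasoning

N*s+s*NC2≡s*[N+1]C2 : ∀ N s → N * s + s * (N C 2) ≡ s * (suc N C 2)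
N*s+s*NC2≡s*[N+1]C2 N s = begin
  N * s + s * (N C 2)      ≡⟨ cong (_+ s * (N C 2)) (*-comm N s) ⟩
  s * N + s * (N C 2)      ≡⟨ *-distribˡ-+ s N (N C 2) ⟨
  s * (N + N C 2)          ≡⟨ cong (λ x → s * (x + N C 2)) (nC1≡n N) ⟨
  s * (N C 1 + N C 2)      ≡⟨ cong (s *_) (nCk+nC[k+1]≡[n+1]C[k+1] N 1) ⟩
  s * (suc N C 2)          ∎
  where open ≡-Reasoning

bonferroni : ∀ {c t s} N (f : Fin N → Subset c) →
             (∀ i → ∣ f i ∣ ≡ t) → (∀ i j → i ≢ j → ∣ f i ∩ f j ∣ ≤ s) →
             N * t ≤ ∣ ⋃[ f ] ∣ + s * (N C 2)
bonferroni zero f size shared≤s = z≤n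
bonferroni {t = t} {s} (suc N) f size shared≤s = begin
  t + N * t                                   ≤⟨ +-mono-≤ (≤-reflexive (sym (size zero))) ih ⟩
  ∣ f zero ∣ + (∣ ⋃f′ ∣ + s * (N C 2))         ≡⟨ +-assoc ∣ f zero ∣ _ _ ⟨
  (∣ f zero ∣ + ∣ ⋃f′ ∣) + s * (N C 2)         ≡⟨ cong (_+ s * (N C 2)) (∣p∪q∣+∣p∩q∣≡∣p∣+∣q∣ (f zero) ⋃f′) ⟨
  (∣ ⋃[ f ] ∣ + ∣ f zero ∩ ⋃f′ ∣) + s * (N C 2) ≤⟨ +-monoˡ-≤ (s * (N C 2)) (+-monoʳ-≤ ∣ ⋃[ f ] ∣ first∩rest≤N*s) ⟩
  (∣ ⋃[ f ] ∣ + N * s) + s * (N C 2)           ≡⟨ +-assoc ∣ ⋃[ f ] ∣ _ _ ⟩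
  ∣ ⋃[ f ] ∣ + (N * s + s * (N C 2))           ≡⟨ cong (∣ ⋃[ f ] ∣ +_) (N*s+s*NC2≡s*[N+1]C2 N s) ⟩
  ∣ ⋃[ f ] ∣ + s * (suc N C 2)                 ∎
  where
  open ≤-Reasoning
  ⋃f′ = ⋃[ f ∘ suc ]
  ih : N * t ≤ ∣ ⋃f′ ∣ + s * (N C 2)
  ih = bonferroni N (f ∘ suc) (size ∘ suc)
         (λ i j i≢j → shared≤s (suc i) (suc j) (i≢j ∘ Finₚ.suc-injective))
  first∩rest≤N*s : ∣ f zero ∩ ⋃f′ ∣ ≤ N * s
  first∩rest≤N*s = ∣p∩⋃f∣≤N*s N (f ∘ suc) (f zero) (λ i → shared≤s zero (suc i) (λ ()))

blocks : ∀ N t → Fin N → Subset (N * t)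
blocks (suc N) t zero    = ⊤ {t} ++ ⊥ {N * t}
blocks (suc N) t (suc i) = ⊥ {t} ++ blocks N t i

∣blocks∣≡t : ∀ N t i → ∣ blocks N t i ∣ ≡ t
∣blocks∣≡t (suc N) t zero =
  trans (∣p++q∣≡∣p∣+∣q∣ (⊤ {t}) (⊥ {N * t}))
        (trans (cong₂ _+_ (∣⊤∣≡n t) (∣⊥∣≡0 (N * t))) (+-identityʳ t))
∣blocks∣≡t (suc N) t (suc i) =
  trans (∣p++q∣≡∣p∣+∣q∣ (⊥ {t}) (blocks N t i))
        (cong₂ _+_ (∣⊥∣≡0 t) (∣blocks∣≡t N t i))

blocks-disjoint : ∀ N t i j → i ≢ j → ∣ blocks N t i ∩ blocks N t j ∣ ≡ 0
blocks-disjoint (suc N) t zero zero i≢j = ⊥-elim (i≢j refl)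
blocks-disjoint (suc N) t zero (suc j) _ =
  trans (∣p++q∩p′++q′∣ (⊤ {t}) ⊥ (⊥ {N * t}) (blocks N t j))
        (cong₂ _+_ (∣p∩⊥∣≡0 (⊤ {t})) (∣⊥∩p∣≡0 (blocks N t j)))
blocks-disjoint (suc N) t (suc i) zero _ =
  trans (∣p++q∩p′++q′∣ (⊥ {t}) ⊤ (blocks N t i) (⊥ {N * t}))
        (cong₂ _+_ (∣⊥∩p∣≡0 (⊤ {t})) (∣p∩⊥∣≡0 (blocks N t i)))
blocks-disjoint (suc N) t (suc i) (suc j) i≢j =
  trans (∣p++q∩p′++q′∣ (⊥ {t}) ⊥ (blocks N t i) (blocks N t j))
        (cong₂ _+_ (∣⊥∩p∣≡0 (⊥ {t})) (blocks-disjoint N t i j (i≢j ∘ cong suc)))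

-- Walks, distances and t-tone colourings in an arbitrary graph

module _ (G : Graph) where
  open Graph G using (n; adj)

  walk? : ∀ m u v → Dec (Walk G u v m)
  walk? zero    u v = map′ (λ { refl → here }) (λ { here → refl }) (u Finₚ.≟ v)
  walk? (suc m) u v =
    map′ (λ (w , uw , wv) → step uw wv) (λ { (step uw wv) → _ , uw , wv })
         (Finₚ.any? λ w → T? (adj u w) ×-dec walk? m w v)

  walk⇒dist : ∀ {u v m} → Walk G u v m → ∃ λ d → Dist G u v d × d ≤ m
  walk⇒dist {u} {v} {m} w with least (λ l → walk? l u v) w
  ... | d , dist = d , dist , proj₂ dist m w

  -- Colour sets sharing x colours are allowed exactly when there is no walk
  -- of length at most x.
  separated? : ∀ u v x → Dec (∀ d → Dist G u v d → x < d)
  separated? u v x =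
    map′ (λ noWalk d (w , _) → ≰⇒> (λ d≤x → noWalk {d} (s≤s d≤x) w))
         (λ far {m} m<1+x w →
            let d , dist , d≤m = walk⇒dist w
            in <⇒≱ (far d dist) (≤-trans d≤m (≤-pred m<1+x)))
         (allUpTo? (λ m → ¬? (walk? m u v)) (suc x))

  IsToneColoring : ∀ t {c} → (Fin n → Subset c) → Set
  IsToneColoring t f =
    (∀ v → ∣ f v ∣ ≡ t) × (∀ u v → u ≢ v → ∀ d → Dist G u v d → ∣ f u ∩ f v ∣ < d)

  module _ (t : ℕ) where

    isToneColoring? : ∀ {c} (f : Fin n → Subset c) → Dec (IsToneColoring t f)
    isToneColoring? f =
      Finₚ.all? (λ v → ∣ f v ∣ ≟ t) ×-dec
      Finₚ.all? (λ u → Finₚ.all? λ v → ¬? (u Finₚ.≟ v) →-dec separated? u v _)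

    isToneColoring-resp : ∀ {c} {f g : Fin n → Subset c} → (∀ v → f v ≡ g v) →
                          IsToneColoring t f → IsToneColoring t g
    isToneColoring-resp f≗g (size , sep) =
      (λ v → subst (λ p → ∣ p ∣ ≡ t) (f≗g v) (size v)) ,
      (λ u v u≢v d dist → subst (_< d) (cong₂ (λ p q → ∣ p ∩ q ∣) (f≗g u) (f≗g v))
                                         (sep u v u≢v d dist))

    toneColoring? : ∀ c → Dec (ToneColoring G t c)
    toneColoring? c = search-Fin→ anySubset? n isToneColoring-resp isToneColoring?

    blockColoring : ToneColoring G t (n * t)
    blockColoring =
      blocks n t , ∣blocks∣≡t n t ,
      λ { u v u≢v zero (here , _) → ⊥-elim (u≢v refl)
        ; u v u≢v (suc d) _ → subst (_< suc d) (sym (blocks-disjoint n t u v u≢v)) (s≤s z≤n) }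

    τ-exists : ∃ λ m → IsTau G t m × m ≤ n * t
    τ-exists with least toneColoring? blockColoring
    ... | m , isTau = m , isTau , proj₂ isTau _ blockColoring

    τ-lowerBound : ∀ {c s} → (∀ u v → ∃ λ l → Walk G u v l × l ≤ suc s) →
                   ToneColoring G t c → n * t ≤ c + s * (n C 2)
    τ-lowerBound {s = s} diameter (f , size , sep) =
      ≤-trans (bonferroni n f size shared≤s) (+-monoˡ-≤ _ (∣p∣≤n ⋃[ f ]))
      where
      shared≤s : ∀ u v → u ≢ v → ∣ f u ∩ f v ∣ ≤ s
      shared≤s u v u≢v =
        let l , w , l≤1+s = diameter u v
            d , dist , d≤l = walk⇒dist w
        in ≤-pred (≤-trans (sep u v u≢v d dist) (≤-trans d≤l l≤1+s))

-- Acyclicity through internal vertices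

module _ (G : Graph) where
  open Graph G using (n)

  Adj-sym : ∀ {u v} → Adj G u v → Adj G v u
  Adj-sym {u} {v} = subst T (Graph.sym G u v)

  Internal : Fin n → Set
  Internal b = ∃₂ λ a c → a ≢ c × Adj G a b × Adj G b c

  unique-neighbour⇒¬internal : ∀ {b w} → (∀ c → Adj G b c → c ≡ w) → ¬ Internal b
  unique-neighbour⇒¬internal only-w (a , c , a≢c , ab , bc) =
    a≢c (trans (only-w a (Adj-sym ab)) (sym (only-w c bc)))

  -- Every vertex of a cycle is internal, and a cycle has at least three vertices.
  acyclic-if-two-internal :
    (∀ {x y z} → Internal x → Internal y → Internal z → x ≡ y ⊎ y ≡ z ⊎ x ≡ z) →
    Acyclic G
  acyclic-if-two-internal two (x ∷ []) (s≤s () , _)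
  acyclic-if-two-internal two (x ∷ y ∷ []) (s≤s (s≤s ()) , _)
  acyclic-if-two-internal two (x ∷ y ∷ z ∷ [])
    (_ , (x≢y ∷ x≢z ∷ []) ∷ (y≢z ∷ []) ∷ _ , xy ∷ yz ∷ zx ∷ [-]) =
    [ x≢y , [ y≢z , x≢z ]′ ]′
      (two (z , y , y≢z ∘ sym , zx , xy) (x , z , x≢z , xy , yz) (y , x , x≢y ∘ sym , yz , zx))
  acyclic-if-two-internal two (x ∷ y ∷ z ∷ w ∷ [])
    (_ , (x≢y ∷ x≢z ∷ _) ∷ (y≢z ∷ y≢w ∷ []) ∷ (z≢w ∷ []) ∷ _ , xy ∷ yz ∷ zw ∷ wx ∷ [-]) =
    [ y≢z , [ z≢w , y≢w ]′ ]′
      (two (x , z , x≢z , xy , yz) (y , w , y≢w , yz , zw) (z , x , x≢z ∘ sym , zw , wx))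
  acyclic-if-two-internal two (x ∷ y ∷ z ∷ w ∷ v ∷ _)
    (_ , (x≢y ∷ x≢z ∷ _) ∷ (y≢z ∷ y≢w ∷ _) ∷ (z≢w ∷ z≢v ∷ _) ∷ _ , xy ∷ yz ∷ zw ∷ wv ∷ _) =
    [ y≢z , [ z≢w , y≢w ]′ ]′
      (two (x , z , x≢z , xy , yz) (y , w , y≢w , yz , zw) (z , v , z≢v , zw , wv))

-- The broom: the path tip – neck – hub with m further leaves at the hub

pattern tip        = zero
pattern neck       = suc zero
pattern hub        = suc (suc zero)
pattern bristle i  = suc (suc (suc i))

broomEdge : ∀ m → Fin (3 + m) → Fin (3 + m) → Bool
broomEdge m tip neck        = true
broomEdge m neck hub        = true
broomEdge m hub (bristle _) = true
broomEdge m _ _             = false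

broomAdj : ∀ m → Fin (3 + m) → Fin (3 + m) → Bool
broomAdj m u v = broomEdge m u v ∨ broomEdge m v u

broomEdge-irrefl : ∀ m v → broomEdge m v v ≡ false
broomEdge-irrefl m tip         = refl
broomEdge-irrefl m neck        = refl
broomEdge-irrefl m hub         = refl
broomEdge-irrefl m (bristle i) = refl

Broom : ℕ → Graph
Broom m = record
  { n      = 3 + m
  ; adj    = broomAdj m
  ; sym    = λ u v → ∨-comm (broomEdge m u v) (broomEdge m v u)
  ; irrefl = λ v → cong₂ _∨_ (broomEdge-irrefl m v) (broomEdge-irrefl m v)
  }

broom-diameter : ∀ m (u v : Fin (3 + m)) → ∃ λ l → Walk (Broom m) u v l × l ≤ 3
broom-diameter m tip         tip         = 0 , here , z≤n
broom-diameter m tip         neck        = 1 , step tt here , s≤s z≤n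
broom-diameter m tip         hub         = 2 , step {w = neck} tt (step tt here) , s≤s (s≤s z≤n)
broom-diameter m tip         (bristle j) = 3 , step {w = neck} tt (step {w = hub} tt (step tt here)) , ≤-refl
broom-diameter m neck        tip         = 1 , step tt here , s≤s z≤n
broom-diameter m neck        neck        = 0 , here , z≤n
broom-diameter m neck        hub         = 1 , step tt here , s≤s z≤n
broom-diameter m neck        (bristle j) = 2 , step {w = hub} tt (step tt here) , s≤s (s≤s z≤n)
broom-diameter m hub         tip         = 2 , step {w = neck} tt (step tt here) , s≤s (s≤s z≤n)
broom-diameter m hub         neck        = 1 , step tt here , s≤s z≤n
broom-diameter m hub         hub         = 0 , here , z≤n
broom-diameter m hub         (bristle j) = 1 , step tt here , s≤s z≤n
broom-diameter m (bristle i) tip         = 3 , step {w = hub} tt (step {w = neck} tt (step tt here)) , ≤-refl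
broom-diameter m (bristle i) neck        = 2 , step {w = hub} tt (step tt here) , s≤s (s≤s z≤n)
broom-diameter m (bristle i) hub         = 1 , step tt here , s≤s z≤n
broom-diameter m (bristle i) (bristle j) = 2 , step {w = hub} tt (step tt here) , s≤s (s≤s z≤n)

broom-internal : ∀ m {b} → Internal (Broom m) b → b ≡ neck ⊎ b ≡ hub
broom-internal m {tip}       = ⊥-elim ∘ unique-neighbour⇒¬internal (Broom m) tip-neighbour
  where
  tip-neighbour : ∀ c → Adj (Broom m) tip c → c ≡ neck
  tip-neighbour neck _ = refl
  tip-neighbour tip         ()
  tip-neighbour hub         ()
  tip-neighbour (bristle _) ()
broom-internal m {neck}      _ = inj₁ refl
broom-internal m {hub}       _ = inj₂ refl
broom-internal m {bristle i} = ⊥-elim ∘ unique-neighbour⇒¬internal (Broom m) bristle-neighbour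
  where
  bristle-neighbour : ∀ c → Adj (Broom m) (bristle i) c → c ≡ hub
  bristle-neighbour hub _ = refl
  bristle-neighbour tip         ()
  bristle-neighbour neck        ()
  bristle-neighbour (bristle _) ()

broom-isTree : ∀ m → IsTree (Broom m)
broom-isTree m =
  (λ u v → let l , w , _ = broom-diameter m u v in l , w) ,
  acyclic-if-two-internal (Broom m) two
  where
  two : ∀ {x y z} → Internal (Broom m) x → Internal (Broom m) y → Internal (Broom m) z →
        x ≡ y ⊎ y ≡ z ⊎ x ≡ z
  two ix iy iz with broom-internal m ix | broom-internal m iy | broom-internal m iz
  ... | inj₁ refl | inj₁ refl | _         = inj₁ refl
  ... | inj₂ refl | inj₂ refl | _         = inj₁ refl
  ... | _         | inj₁ refl | inj₁ refl = inj₂ (inj₁ refl)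
  ... | _         | inj₂ refl | inj₂ refl = inj₂ (inj₁ refl)
  ... | inj₁ refl | inj₂ refl | inj₁ refl = inj₂ (inj₂ refl)
  ... | inj₂ refl | inj₁ refl | inj₂ refl = inj₂ (inj₂ refl)

∣tabulate-outside∣ : ∀ n → ∣ tabulate {n = n} (λ _ → outside) ∣ ≡ 0
∣tabulate-outside∣ n = trans (∣tabulate-const∣ n outside) (∣⊥∣≡0 n)

∣tabulate-inside∣ : ∀ n → ∣ tabulate {n = n} (λ _ → inside) ∣ ≡ n
∣tabulate-inside∣ n = trans (∣tabulate-const∣ n inside) (∣⊤∣≡n n)

broom-maxDegree : ∀ m → MaxDegree (Broom (suc m)) (2 + m)
broom-maxDegree m = degree≤ , hub , cong suc (∣tabulate-inside∣ (suc m))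
  where
  open ≤-Reasoning
  off-hub-degree≤ : ∀ d → d ≤ 2 → d + ∣ tabulate {n = suc m} (λ _ → outside) ∣ ≤ 2 + m
  off-hub-degree≤ d d≤2 = begin
    d + ∣ tabulate {n = suc m} (λ _ → outside) ∣ ≡⟨ cong (d +_) (∣tabulate-outside∣ (suc m)) ⟩
    d + 0                           ≡⟨ +-identityʳ d ⟩
    d                               ≤⟨ d≤2 ⟩
    2                               ≤⟨ s≤s (s≤s z≤n) ⟩
    2 + m                           ∎
  degree≤ : ∀ v → degree (Broom (suc m)) v ≤ 2 + m
  degree≤ tip         = off-hub-degree≤ 1 (s≤s z≤n)
  degree≤ neck        = off-hub-degree≤ 2 ≤-refl
  degree≤ hub         = ≤-reflexive (cong suc (∣tabulate-inside∣ (suc m)))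
  degree≤ (bristle i) = off-hub-degree≤ 1 (s≤s z≤n)

slack-gap : ∀ N s b → suc N * suc s ≤ b + s → N * suc s < b
slack-gap N s b h = +-cancelˡ-< s (N * suc s) b (begin-strict
  s + N * suc s     <⟨ ≤-refl ⟩
  suc s + N * suc s ≤⟨ h ⟩
  b + s             ≡⟨ +-comm b s ⟩
  s + b             ∎)
  where open ≤-Reasoning

proposition6p4 : ∀ (k : ℕ) → 2 ≤ k →
    ∃ λ (t : ℕ) → 1 ≤ t × Σ Graph λ T → IsTree T × MaxDegree T k ×
      ∃ λ (a : ℕ) → ∃ λ (b : ℕ) → IsTau (Star k) t a × IsTau T t b × a < b
proposition6p4 zero          ()
proposition6p4 (suc zero)    (s≤s ())
proposition6p4 k@(suc (suc j)) _ =
  let a , τ-star , a≤[k+1]t = τ-exists (Star k) t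
      b , τ-broom , _       = τ-exists (Broom (suc j)) t
      broom-bound           = τ-lowerBound (Broom (suc j)) t (broom-diameter (suc j)) (proj₁ τ-broom)
  in t , s≤s z≤n , Broom (suc j) , broom-isTree (suc j) , broom-maxDegree j ,
     a , b , τ-star , τ-broom , ≤-<-trans a≤[k+1]t (slack-gap (suc k) slack b broom-bound)
  where
  slack = 2 * ((2 + k) C 2)
  t = suc slack
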